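{- Let $(\mathcal{T}_r)_{r\in\mathbb{Z}}$ be a sequence of complex numbers satisfying $\mathcal{T}_r=\mathcal{T}_{r-1}+\mathcal{T}_{r-2}+\mathcal{T}_{r-3}$ for all integers $r$. Then for every non-negative integer $k$: \[ \begin{aligned} 8\sum_{j=0}^k \mathcal{T}_j^2 &= 9(\mathcal{T}_k^2-\mathcal{T}_{ -1}^2) + 7(\mathcal{T}_{k-1}^2-\mathcal{T}_{ -2}^2) + 4(\mathcal{T}_{k-2}^2-\mathcal{T}_{ -3}^2)\\ &\quad - 2(\mathcal{T}_{k-3}^2-\mathcal{T}_{ -4}^2) - (\mathcal{T}_{k-4}^2-\mathcal{T}_{ -5}^2) - (\mathcal{T}_{k-5}^2-\mathcal{T}_{ -6}^2). \end{aligned} \]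
   Context: A generalized Tribonacci sequence is determined by arbitrary initial values $\mathcal{T}_0,\mathcal{T}_1,\mathcal{T}_2$ and the recurrence $\mathcal{T}_r=\mathcal{T}_{r-1}+\mathcal{T}_{r-2}+\mathcal{T}_{r-3}$, extended to all integer indices. -}

module Defs where

open import Algebra.Bundles using (CommutativeRing)
open import Data.Nat using (ℕ; zero; suc)

module _ {c ℓ} (R : CommutativeRing c ℓ) where
  open CommutativeRing R using (Carrier; _+_; _*_; 0#)

  sumTo : ℕ → (ℕ → Carrier) → Carrier
  sumTo zero    f = f zero
  sumTo (suc k) f = sumTo k f + f (suc k)

  natMul : ℕ → Carrier → Carrier
  natMul zero    x = 0#
  natMul (suc n) x = natMul n x + x

  sq : Carrier → Carrier
  sq x = x * x

{-# OPTIONS --safe #-}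
-- With Φ(n) = 9 T(n)² + 7 T(n-1)² + 4 T(n-2)² - 2 T(n-3)² - T(n-4)² - T(n-5)², the right-hand
-- side is Φ(k) - Φ(-1), so it suffices that Φ(n) - Φ(n-1) = 8 T(n)² and to telescope.  That
-- step is T(n)² + T(n-4)² + T(n-6)² = 2 T(n-1)² + 3 T(n-2)² + 6 T(n-3)², a polynomial identity
-- once the recurrence expresses T(n), ..., T(n-3) through T(n-4), T(n-5), T(n-6); it is checked
-- by the ring solver instantiated with integer coefficients.
module Submission where

open import Defs
open import Algebra.Bundles using (CommutativeRing)
open import Data.Nat as ℕ using (ℕ; zero; suc)
open import Data.Integer as ℤ using (ℤ; +_; -[1+_]; _⊖_)
import Data.Integer.Properties as ℤ
import Data.Nat.Properties as ℕ
open import Data.Maybe using (Maybe; map)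
open import Function using (_∘_)
open import Relation.Binary.Consequences using (dec⇒weaklyDec)
open import Relation.Binary.PropositionalEquality as ≡ using (_≡_)
open import Algebra.Solver.Ring.AlmostCommutativeRing
  using (fromCommutativeRing; _-Raw-AlmostCommutative⟶_)

module IntegerCoefficients {c ℓ} (R : CommutativeRing c ℓ) where
  open CommutativeRing R
  open import Algebra.Properties.Ring ring
    using (-0#≈0#; -‿involutive; -‿+-comm; -‿distribˡ-*; -‿distribʳ-*)
  open import Algebra.Properties.CommutativeSemigroup +-commutativeSemigroup
    using (interchange)
  open import Algebra.Properties.Semiring.Mult semiring
    using (_×_; ×-congˡ; ×-homo-+; ×1-homo-*)
  open import Relation.Binary.Reasoning.Setoid setoid

  fromℤ : ℤ → Carrier
  fromℤ (+ n)    = n × 1#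
  fromℤ -[1+ n ] = - (suc n × 1#)

  fromℤ-⊖ : ∀ m n → fromℤ (m ⊖ n) ≈ m × 1# - n × 1#
  fromℤ-⊖ m       zero    = sym (trans (+-congˡ -0#≈0#) (+-identityʳ _))
  fromℤ-⊖ zero    (suc n) = sym (+-identityˡ _)
  fromℤ-⊖ (suc m) (suc n) rewrite ℤ.[1+m]⊖[1+n]≡m⊖n m n =
    trans (fromℤ-⊖ m n) (sym (cancel-1# (m × 1#) (n × 1#)))
    where
    cancel-1# : ∀ a b → (1# + a) - (1# + b) ≈ a - b
    cancel-1# a b = begin
      (1# + a) - (1# + b)    ≈⟨ +-congˡ (-‿+-comm 1# b) ⟨
      (1# + a) + (- 1# - b)  ≈⟨ interchange 1# a (- 1#) (- b) ⟩
      (1# - 1#) + (a - b)    ≈⟨ +-congʳ (-‿inverseʳ 1#) ⟩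
      0# + (a - b)           ≈⟨ +-identityˡ _ ⟩
      a - b                  ∎

  fromℤ-neg : ∀ i → fromℤ (ℤ.- i) ≈ - fromℤ i
  fromℤ-neg (+ zero)  = sym -0#≈0#
  fromℤ-neg (+ suc n) = refl
  fromℤ-neg -[1+ n ]  = sym (-‿involutive _)

  fromℤ-+ : ∀ i j → fromℤ (i ℤ.+ j) ≈ fromℤ i + fromℤ j
  fromℤ-+ (+ m)    (+ n)    = ×-homo-+ 1# m n
  fromℤ-+ (+ m)    -[1+ n ] = fromℤ-⊖ m (suc n)
  fromℤ-+ -[1+ m ] (+ n)    = trans (fromℤ-⊖ n (suc m)) (+-comm _ _)
  fromℤ-+ -[1+ m ] -[1+ n ] = trans
    (-‿cong (trans (×-congˡ (≡.cong suc (≡.sym (ℕ.+-suc m n)))) (×-homo-+ 1# (suc m) (suc n))))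
    (sym (-‿+-comm _ _))

  fromℤ-*-pos : ∀ m n → fromℤ (+ m ℤ.* + n) ≈ fromℤ (+ m) * fromℤ (+ n)
  fromℤ-*-pos m n = trans (reflexive (≡.cong fromℤ (≡.sym (ℤ.pos-* m n)))) (×1-homo-* m n)

  fromℤ-* : ∀ i j → fromℤ (i ℤ.* j) ≈ fromℤ i * fromℤ j
  fromℤ-* (+ m)    (+ n)    = fromℤ-*-pos m n
  fromℤ-* (+ m)    -[1+ n ] = begin
    fromℤ (+ m ℤ.* -[1+ n ])         ≡⟨ ≡.cong fromℤ (ℤ.neg-distribʳ-* (+ m) (+ suc n)) ⟨
    fromℤ (ℤ.- (+ m ℤ.* + suc n))    ≈⟨ fromℤ-neg (+ m ℤ.* + suc n) ⟩
    - fromℤ (+ m ℤ.* + suc n)        ≈⟨ -‿cong (fromℤ-*-pos m (suc n)) ⟩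
    - (fromℤ (+ m) * fromℤ (+ suc n)) ≈⟨ -‿distribʳ-* _ _ ⟩
    fromℤ (+ m) * fromℤ -[1+ n ]      ∎
  fromℤ-* -[1+ m ] (+ n)    = begin
    fromℤ (-[1+ m ] ℤ.* + n)          ≡⟨ ≡.cong fromℤ (ℤ.neg-distribˡ-* (+ suc m) (+ n)) ⟨
    fromℤ (ℤ.- (+ suc m ℤ.* + n))     ≈⟨ fromℤ-neg (+ suc m ℤ.* + n) ⟩
    - fromℤ (+ suc m ℤ.* + n)         ≈⟨ -‿cong (fromℤ-*-pos (suc m) n) ⟩
    - (fromℤ (+ suc m) * fromℤ (+ n)) ≈⟨ -‿distribˡ-* _ _ ⟩
    fromℤ -[1+ m ] * fromℤ (+ n)      ∎
  fromℤ-* -[1+ m ] -[1+ n ] = begin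
    fromℤ (+ suc m ℤ.* + suc n)        ≈⟨ fromℤ-*-pos (suc m) (suc n) ⟩
    a * b                              ≈⟨ -‿involutive (a * b) ⟨
    - - (a * b)                        ≈⟨ -‿cong (-‿distribˡ-* a b) ⟩
    - (- a * b)                        ≈⟨ -‿distribʳ-* (- a) b ⟩
    - a * - b                          ∎
    where
    a b : Carrier
    a = fromℤ (+ suc m)
    b = fromℤ (+ suc n)

  homomorphism : ℤ.+-*-rawRing -Raw-AlmostCommutative⟶ fromCommutativeRing R
  homomorphism = record
    { ⟦_⟧    = fromℤ
    ; +-homo = fromℤ-+
    ; *-homo = fromℤ-*
    ; -‿homo = fromℤ-neg
    ; 0-homo = refl
    ; 1-homo = +-identityʳ 1#
    }

  fromℤ-≟ : ∀ i j → Maybe (fromℤ i ≈ fromℤ j)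
  fromℤ-≟ i j = map (reflexive ∘ ≡.cong fromℤ) (dec⇒weaklyDec ℤ._≟_ i j)

  open import Algebra.Solver.Ring ℤ.+-*-rawRing (fromCommutativeRing R) homomorphism fromℤ-≟ public

i-m-n≡i-[m+n] : ∀ i m n → i ℤ.- + m ℤ.- + n ≡ i ℤ.- + (m ℕ.+ n)
i-m-n≡i-[m+n] i m n = begin
  i ℤ.- + m ℤ.- + n            ≡⟨ ℤ.+-assoc i (ℤ.- + m) (ℤ.- + n) ⟩
  i ℤ.+ (ℤ.- + m ℤ.- + n)      ≡⟨ ≡.cong (λ j → i ℤ.+ j) (ℤ.neg-distrib-+ (+ m) (+ n)) ⟨
  i ℤ.- + (m ℕ.+ n)            ∎
  where open ≡.≡-Reasoning

module _ {c ℓ} (R : CommutativeRing c ℓ) where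
  open CommutativeRing R
  open IntegerCoefficients R using (Polynomial; con; _:+_; _:*_; _:-_; solve; _:=_)
  open import Algebra.Properties.CommutativeSemigroup +-commutativeSemigroup
    using (interchange)
  open import Relation.Binary.Reasoning.Setoid setoid

  sq-cong : ∀ {x y} → x ≈ y → sq R x ≈ sq R y
  sq-cong x≈y = *-cong x≈y x≈y

  natMul-cong : ∀ n {x y} → x ≈ y → natMul R n x ≈ natMul R n y
  natMul-cong zero    x≈y = refl
  natMul-cong (suc n) x≈y = +-cong (natMul-cong n x≈y) x≈y

  natMul-distribˡ-+ : ∀ n x y → natMul R n (x + y) ≈ natMul R n x + natMul R n y
  natMul-distribˡ-+ zero    x y = sym (+-identityˡ 0#)
  natMul-distribˡ-+ (suc n) x y =
    trans (+-congʳ (natMul-distribˡ-+ n x y)) (interchange _ _ _ _)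

  natMul-sumTo : ∀ n k f → natMul R n (sumTo R k f) ≈ sumTo R k (λ j → natMul R n (f j))
  natMul-sumTo n zero    f = refl
  natMul-sumTo n (suc k) f =
    trans (natMul-distribˡ-+ n _ _) (+-congʳ (natMul-sumTo n k f))

  sumTo-telescope : (F : ℤ → Carrier) (f : ℕ → Carrier) →
    (∀ j → F (+ j) ≈ F (+ j ℤ.- + 1) + f j) →
    ∀ k → sumTo R k f ≈ F (+ k) - F (ℤ.- + 1)
  sumTo-telescope F f step zero = begin
    f 0                                ≈⟨ solve 2 (λ b v → v := (b :+ v) :- b) refl _ _ ⟩
    (F (ℤ.- + 1) + f 0) - F (ℤ.- + 1)  ≈⟨ +-congʳ (step 0) ⟨
    F (+ 0) - F (ℤ.- + 1)              ∎
  -- step (suc k) fits the last step because + suc k ℤ.- + 1 reduces to + k.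
  sumTo-telescope F f step (suc k) = begin
    sumTo R k f + f (suc k)                 ≈⟨ +-congʳ (sumTo-telescope F f step k) ⟩
    (F (+ k) - F (ℤ.- + 1)) + f (suc k)      ≈⟨ solve 3 (λ u b v → (u :- b) :+ v := (u :+ v) :- b) refl _ _ _ ⟩
    (F (+ k) + f (suc k)) - F (ℤ.- + 1)      ≈⟨ +-congʳ (step (suc k)) ⟨
    F (+ suc k) - F (ℤ.- + 1)               ∎

  potential : (a₀ a₁ a₂ a₃ a₄ a₅ : Carrier) → Carrier
  potential a₀ a₁ a₂ a₃ a₄ a₅ =
    natMul R 9 a₀ + natMul R 7 a₁ + natMul R 4 a₂ - natMul R 2 a₃ - a₄ - a₅

  potential-cong : ∀ {a₀ a₁ a₂ a₃ b₀ b₁ b₂ b₃} a₄ a₅ →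
    a₀ ≈ b₀ → a₁ ≈ b₁ → a₂ ≈ b₂ → a₃ ≈ b₃ →
    potential a₀ a₁ a₂ a₃ a₄ a₅ ≈ potential b₀ b₁ b₂ b₃ a₄ a₅
  potential-cong a₄ a₅ e₀ e₁ e₂ e₃ = +-congʳ (+-congʳ (+-cong
    (+-cong (+-cong (natMul-cong 9 e₀) (natMul-cong 7 e₁)) (natMul-cong 4 e₂))
    (-‿cong (natMul-cong 2 e₃))))

  -- Mirrors natMul clause by clause (unlike _:×_), so that ⟦ natMulᴾ m p ⟧ computes to natMul R m ⟦ p ⟧.
  natMulᴾ : ∀ {n} → ℕ → Polynomial n → Polynomial n
  natMulᴾ zero    p = con (+ 0)
  natMulᴾ (suc m) p = natMulᴾ m p :+ p

  sqᴾ : ∀ {n} → Polynomial n → Polynomial n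
  sqᴾ p = p :* p

  potentialᴾ : ∀ {n} (p₀ p₁ p₂ p₃ p₄ p₅ : Polynomial n) → Polynomial n
  potentialᴾ p₀ p₁ p₂ p₃ p₄ p₅ =
    natMulᴾ 9 p₀ :+ natMulᴾ 7 p₁ :+ natMulᴾ 4 p₂ :- natMulᴾ 2 p₃ :- p₄ :- p₅

  potential-step-identity : ∀ x y z →
    let w₃ = x + y + z
        w₂ = w₃ + x + y
        w₁ = w₂ + w₃ + x
        w₀ = w₁ + w₂ + w₃
    in potential (sq R w₀) (sq R w₁) (sq R w₂) (sq R w₃) (sq R x) (sq R y)
       ≈ potential (sq R w₁) (sq R w₂) (sq R w₃) (sq R x) (sq R y) (sq R z)
         + natMul R 8 (sq R w₀)
  potential-step-identity = solve 3 (λ x y z →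
    let w₃ = x :+ y :+ z
        w₂ = w₃ :+ x :+ y
        w₁ = w₂ :+ w₃ :+ x
        w₀ = w₁ :+ w₂ :+ w₃
    in potentialᴾ (sqᴾ w₀) (sqᴾ w₁) (sqᴾ w₂) (sqᴾ w₃) (sqᴾ x) (sqᴾ y)
       := potentialᴾ (sqᴾ w₁) (sqᴾ w₂) (sqᴾ w₃) (sqᴾ x) (sqᴾ y) (sqᴾ z)
          :+ natMulᴾ 8 (sqᴾ w₀)) refl

  potential-step : ∀ t₀ t₁ t₂ t₃ t₄ t₅ t₆ →
    t₀ ≈ t₁ + t₂ + t₃ → t₁ ≈ t₂ + t₃ + t₄ → t₂ ≈ t₃ + t₄ + t₅ → t₃ ≈ t₄ + t₅ + t₆ →
    potential (sq R t₀) (sq R t₁) (sq R t₂) (sq R t₃) (sq R t₄) (sq R t₅)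
      ≈ potential (sq R t₁) (sq R t₂) (sq R t₃) (sq R t₄) (sq R t₅) (sq R t₆)
        + natMul R 8 (sq R t₀)
  potential-step t₀ t₁ t₂ t₃ t₄ t₅ t₆ h₀ h₁ h₂ h₃ = begin
    potential (sq R t₀) (sq R t₁) (sq R t₂) (sq R t₃) (sq R t₄) (sq R t₅)
      ≈⟨ potential-cong _ _ (sq-cong e₀) (sq-cong e₁) (sq-cong e₂) (sq-cong h₃) ⟩
    potential (sq R w₀) (sq R w₁) (sq R w₂) (sq R w₃) (sq R t₄) (sq R t₅)
      ≈⟨ potential-step-identity t₄ t₅ t₆ ⟩
    potential (sq R w₁) (sq R w₂) (sq R w₃) (sq R t₄) (sq R t₅) (sq R t₆) + natMul R 8 (sq R w₀)
      ≈⟨ +-cong (potential-cong _ _ (sq-cong e₁) (sq-cong e₂) (sq-cong h₃) refl)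
                (natMul-cong 8 (sq-cong e₀)) ⟨
    potential (sq R t₁) (sq R t₂) (sq R t₃) (sq R t₄) (sq R t₅) (sq R t₆) + natMul R 8 (sq R t₀)
      ∎
    where
    w₃ w₂ w₁ w₀ : Carrier
    w₃ = t₄ + t₅ + t₆
    w₂ = w₃ + t₄ + t₅
    w₁ = w₂ + w₃ + t₄
    w₀ = w₁ + w₂ + w₃

    e₂ : t₂ ≈ w₂
    e₂ = trans h₂ (+-congʳ (+-congʳ h₃))
    e₁ : t₁ ≈ w₁
    e₁ = trans h₁ (+-congʳ (+-cong e₂ h₃))
    e₀ : t₀ ≈ w₀
    e₀ = trans h₀ (+-cong (+-cong e₁ e₂) h₃)

  potential-sub : ∀ a₀ a₁ a₂ a₃ a₄ a₅ b₀ b₁ b₂ b₃ b₄ b₅ →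
    potential a₀ a₁ a₂ a₃ a₄ a₅ - potential b₀ b₁ b₂ b₃ b₄ b₅
      ≈ natMul R 9 (a₀ - b₀) + natMul R 7 (a₁ - b₁) + natMul R 4 (a₂ - b₂)
        - natMul R 2 (a₃ - b₃) - (a₄ - b₄) - (a₅ - b₅)
  potential-sub = solve 12 (λ a₀ a₁ a₂ a₃ a₄ a₅ b₀ b₁ b₂ b₃ b₄ b₅ →
    potentialᴾ a₀ a₁ a₂ a₃ a₄ a₅ :- potentialᴾ b₀ b₁ b₂ b₃ b₄ b₅
      := natMulᴾ 9 (a₀ :- b₀) :+ natMulᴾ 7 (a₁ :- b₁) :+ natMulᴾ 4 (a₂ :- b₂)
         :- natMulᴾ 2 (a₃ :- b₃) :- (a₄ :- b₄) :- (a₅ :- b₅)) refl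

  module _ (T : ℤ → Carrier) where

    potentialAt : ℤ → Carrier
    potentialAt n = potential (sq R (T n)) (sq R (T (n ℤ.- + 1))) (sq R (T (n ℤ.- + 2)))
                              (sq R (T (n ℤ.- + 3))) (sq R (T (n ℤ.- + 4))) (sq R (T (n ℤ.- + 5)))

    module _ (recurrence : ∀ r → T r ≈ T (r ℤ.- + 1) + T (r ℤ.- + 2) + T (r ℤ.- + 3)) where

      recurrence-at : ∀ n i →
        T (n ℤ.- + i) ≈ T (n ℤ.- + (i ℕ.+ 1)) + T (n ℤ.- + (i ℕ.+ 2)) + T (n ℤ.- + (i ℕ.+ 3))
      recurrence-at n i
        rewrite ≡.sym (i-m-n≡i-[m+n] n i 1)
              | ≡.sym (i-m-n≡i-[m+n] n i 2)
              | ≡.sym (i-m-n≡i-[m+n] n i 3) = recurrence (n ℤ.- + i)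

      potentialAt-step : ∀ n → potentialAt n ≈ potentialAt (n ℤ.- + 1) + natMul R 8 (sq R (T n))
      potentialAt-step n
        rewrite i-m-n≡i-[m+n] n 1 1
              | i-m-n≡i-[m+n] n 1 2
              | i-m-n≡i-[m+n] n 1 3
              | i-m-n≡i-[m+n] n 1 4
              | i-m-n≡i-[m+n] n 1 5 =
        potential-step _ _ _ _ _ _ _
          (recurrence n) (recurrence-at n 1) (recurrence-at n 2) (recurrence-at n 3)

mainTheorem3 : ∀ {c ℓ} (R : CommutativeRing c ℓ) → let open CommutativeRing R in
    (T : ℤ → Carrier) →
    (∀ r → T r ≈ T (r ℤ.- + 1) + T (r ℤ.- + 2) + T (r ℤ.- + 3)) →
    (k : ℕ) →
    natMul R 8 (sumTo R k (λ j → sq R (T (+ j))))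
      ≈ natMul R 9 (sq R (T (+ k)) - sq R (T (ℤ.- + 1)))
        + natMul R 7 (sq R (T (+ k ℤ.- + 1)) - sq R (T (ℤ.- + 2)))
        + natMul R 4 (sq R (T (+ k ℤ.- + 2)) - sq R (T (ℤ.- + 3)))
        - natMul R 2 (sq R (T (+ k ℤ.- + 3)) - sq R (T (ℤ.- + 4)))
        - (sq R (T (+ k ℤ.- + 4)) - sq R (T (ℤ.- + 5)))
        - (sq R (T (+ k ℤ.- + 5)) - sq R (T (ℤ.- + 6)))
mainTheorem3 R T recurrence k = begin
  natMul R 8 (sumTo R k square)                      ≈⟨ natMul-sumTo R 8 k square ⟩
  sumTo R k (λ j → natMul R 8 (square j))            ≈⟨ sumTo-telescope R (potentialAt R T) _
                                                          (potentialAt-step R T recurrence ∘ +_) k ⟩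
  potentialAt R T (+ k) - potentialAt R T (ℤ.- + 1)  ≈⟨ potential-sub R _ _ _ _ _ _ _ _ _ _ _ _ ⟩
  _                                                  ∎
  where
  open CommutativeRing R using (Carrier; _-_; setoid)
  open import Relation.Binary.Reasoning.Setoid setoid

  square : ℕ → Carrier
  square j = sq R (T (+ j))
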